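{- Let $\mathfrak{M}_0=(S,\mathcal{L}_0)$ be a partial linear space, $k\ge1$, and let $p,L_1,L_2,M_1,M_2$ form an incomplete Veblen configuration in the Veronese space $\mathbf{V}_k(\mathfrak{M}_0)$. Assume moreover that the points in one of the pairs $(L_1\cap M_1,\ L_2\cap M_2)$, $(L_1\cap M_2,\ L_2\cap M_1)$ are collinear. Then the lines $L_1,L_2,M_1,M_2$ are contained in a single leaf of $\mathbf{V}_k(\mathfrak{M}_0)$. Consequently, if $\mathfrak{M}_0$ is veblenian, then $M_1$ and $M_2$ meet.
   Context: A partial linear space is a pair $(S,\mathcal{L})$ where $\mathcal{L}$ is a nonempty family of subsets of $S$ (lines), each line has at least $3$ points, and two distinct points lie on at most one line; two points are collinear if some line contains both. For a set $S$ and integer $k\ge0$, $\mathfrak{y}_k(S)$ is the set of multisets of size $k$ over $S$, i.e. functions $f\colon S\to\mathbb{N}$ with finite support and $|f|:=\sum_x f(x)=k$; multisets are added pointwise, a point $x$ is identified with $1\cdot x$, and $e+rB=\{e+rx:x\in B\}$. The Veronese space $\mathbf{V}_k(\mathfrak{M}_0)$ has point set $\mathfrak{y}_k(S)$ and lines $e+rL$ with $0<r\le k$, $e\in\mathfrak{y}_{k-r}(S)$, $L\in\mathcal{L}_0$. A leaf of $\mathbf{V}_k(\mathfrak{M}_0)$ is a set $e+(k-|e|)S$ with $e$ a multiset over $S$ of size $|e|<k$; every line lies in exactly one leaf. An incomplete Veblen configuration consists of a point $p$ and lines $L_1,L_2,M_1,M_2$ with $p$ on $L_1,L_2$, $p$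 not on $M_1,M_2$, and $L_i\cap M_j\neq\emptyset$ for $i,j\in\{1,2\}$. A partial linear space is veblenian if in every incomplete Veblen configuration $M_1$ and $M_2$ meet. -}

module Defs where

open import Data.Nat using (ℕ; _+_; _∸_; _<_)
open import Data.List using (List; length; _++_; replicate)
open import Data.List.Relation.Binary.Permutation.Propositional using (_↭_)
open import Data.Product using (Σ; ∃; _×_; _,_; proj₁)
open import Data.Sum using (_⊎_)
open import Relation.Nullary using (¬_)
open import Relation.Binary.PropositionalEquality using (_≡_; _≢_)

record Incidence : Set₁ where
  field
    Point : Set
    Line  : Set
    _on_  : Point → Line → Set

module _ (G : Incidence) where
  open Incidence G

  SameLine : Line → Line → Set
  SameLine l m = ∀ x → (x on l → x on m) × (x on m → x on l)

  Meet : Line → Line → Set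
  Meet l m = ∃ λ x → x on l × x on m

  Collinear : Point → Point → Set
  Collinear x y = ∃ λ l → x on l × y on l

  IncVeblen : Point → Line → Line → Line → Line → Set
  IncVeblen p L₁ L₂ M₁ M₂ =
    p on L₁ × p on L₂ × ¬ (p on M₁) × ¬ (p on M₂) ×
    ¬ SameLine L₁ L₂ × ¬ SameLine M₁ M₂ ×
    Meet L₁ M₁ × Meet L₁ M₂ × Meet L₂ M₁ × Meet L₂ M₂

  Veblenian : Set
  Veblenian = ∀ p L₁ L₂ M₁ M₂ → IncVeblen p L₁ L₂ M₁ M₂ → Meet M₁ M₂

-- Partial linear spaces; lines are a family (indexed by I) of subsets of S

record PartialLinearSpace : Set₁ where
  field
    S        : Set
    I        : Set
    L        : I → S → Set
    nonempty : I
    three    : ∀ i → ∃ λ x → ∃ λ y → ∃ λ z →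
                 L i x × L i y × L i z × x ≢ y × x ≢ z × y ≢ z
    unique   : ∀ i j x y → x ≢ y → L i x → L i y → L j x → L j y →
                 ∀ z → (L i z → L j z) × (L j z → L i z)

  asIncidence : Incidence
  asIncidence = record { Point = S ; Line = I ; _on_ = λ x i → L i x }

-- Veronese spaces.  Multisets over S are lists over S up to permutation
-- (_↭_); |e| = length e, sum = _++_, r·x = replicate r x.

module Veronese (M : PartialLinearSpace) (k : ℕ) where
  open PartialLinearSpace M

  VPoint : Set
  VPoint = Σ (List S) (λ f → length f ≡ k)

  -- the line  e + r·L  with 0 < r, |e| = k - r, L = L i
  record VLine : Set where
    constructor vline
    field
      e   : List S
      r   : ℕ
      i   : I
      pos : 0 < r
      len : length e + r ≡ k

  _onV_ : VPoint → VLine → Set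
  q onV ℓ = ∃ λ x → L (VLine.i ℓ) x × proj₁ q ↭ (VLine.e ℓ ++ replicate (VLine.r ℓ) x)

  V : Incidence
  V = record { Point = VPoint ; Line = VLine ; _on_ = _onV_ }

  -- the leaf  e + (k - |e|)·S
  InLeaf : List S → VPoint → Set
  InLeaf e q = ∃ λ x → proj₁ q ↭ (e ++ replicate (k ∸ length e) x)

  LineInLeaf : VLine → List S → Set
  LineInLeaf ℓ e = ∀ q → q onV ℓ → InLeaf e q

  CrossCollinear : VLine → VLine → VLine → VLine → Set
  CrossCollinear L₁ M₁ L₂ M₂ = ∃ λ q₁ → ∃ λ q₂ →
    q₁ onV L₁ × q₁ onV M₁ × q₂ onV L₂ × q₂ onV M₂ × Collinear V q₁ q₂

module Submission where

-- Leaf rigidity: two points e + r·u, e + r·v (u ≠ v) of a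
-- leaf e' + r'·S force e = e' and r = r'.  The three-point lemma: a point
-- adjacent to three points e + r·bᵢ with b₁ ≠ b₂, b₁ ≠ b₃ lies in the leaf
-- e + r·S unless b₂ = b₃; it is proved by classifying, with an exchange
-- lemma for e + r·a = e' + r'·a', the shapes of a point adjacent to e + r·b
-- and comparing two such shapes.
--
-- Geometry: by rigidity, two lines through two distinct points coincide and
-- a line meeting two lines of a leaf in distinct points lies in that leaf.
-- A pivot step built on the three-point lemma puts L₁ and L₂ in one leaf,
-- hence also M₁ and M₂.  Inside a leaf the configuration is a copy of one
-- in 𝔐, which yields the veblenian consequence.

open import Defs
open import Data.Nat using (ℕ; _≤_; _<_)
open import Data.List using (List; length)
open import Data.Product using (∃; _×_)
open import Data.Sum using (_⊎_)

open import Data.Nat using (zero; suc; _+_; _∸_)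
open import Data.Nat.Properties using (+-comm; ≤-total; m≤n⇒∃[o]m+o≡n; m+n∸m≡n; m<m+n)
open import Data.List using ([]; _∷_; _++_; replicate)
open import Data.List.Properties using (length-++; length-replicate)
open import Data.List.Membership.Propositional using (_∈_)
open import Data.List.Membership.Propositional.Properties using (∈-++⁻; ∈-++⁺ˡ; ∈-++⁺ʳ; ∈-∃++)
open import Data.List.Relation.Unary.Any using (here; there)
open import Data.List.Relation.Binary.Permutation.Propositional
  using (_↭_; ↭-refl; ↭-sym; ↭-trans; ↭-reflexive; prep)
open import Data.List.Relation.Binary.Permutation.Propositional.Properties
  using (++-commutativeMonoid; ++⁺; ++⁺ˡ; ++⁺ʳ; ++-comm; ++-assoc; ++-identityʳ;
         drop-∷; drop-mid; shift; ∈-resp-↭)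
open import Data.Product using (_,_; proj₁; proj₂; swap)
open import Data.Sum using (inj₁; inj₂; [_,_]; map₂)
open import Data.Empty using (⊥-elim)
open import Function using (case_of_)
open import Relation.Nullary using (¬_)
open import Relation.Binary.PropositionalEquality using (_≡_; _≢_; refl; sym; trans; cong; subst)
import Algebra.Solver.CommutativeMonoid as CommutativeMonoidSolver

module Multisets {S : Set} where
  open CommutativeMonoidSolver (++-commutativeMonoid {A = S}) using (solve; _⊜_; _⊕_)

  infix  6 _·_
  infixr 4.5 _⨾_

  _·_ : ℕ → S → List S
  r · x = replicate r x

  _⨾_ : {xs ys zs : List S} → xs ↭ ys → ys ↭ zs → xs ↭ zs
  _⨾_ = ↭-trans

  swap-last : (a b c : List S) → (a ++ b) ++ c ↭ (a ++ c) ++ b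
  swap-last = solve 3 (λ a b c → (a ⊕ b) ⊕ c ⊜ (a ⊕ c) ⊕ b) ↭-refl

  swap-inner : (a b c : List S) → a ++ (b ++ c) ↭ (a ++ c) ++ b
  swap-inner = solve 3 (λ a b c → a ⊕ (b ⊕ c) ⊜ (a ⊕ c) ⊕ b) ↭-refl

  interchange : (a b c d : List S) → (a ++ b) ++ (c ++ d) ↭ (a ++ c) ++ (b ++ d)
  interchange = solve 4 (λ a b c d → (a ⊕ b) ⊕ (c ⊕ d) ⊜ (a ⊕ c) ⊕ (b ⊕ d)) ↭-refl

  regroup : (a b c d : List S) → ((a ++ b) ++ c) ++ d ↭ (a ++ d) ++ (b ++ c)
  regroup = solve 4 (λ a b c d → ((a ⊕ b) ⊕ c) ⊕ d ⊜ (a ⊕ d) ⊕ (b ⊕ c)) ↭-refl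

  ·-+ : ∀ m n x → (m + n) · x ≡ m · x ++ n · x
  ·-+ zero    n x = refl
  ·-+ (suc m) n x = cong (x ∷_) (·-+ m n x)

  ·-cong : ∀ {m n} x → m ≡ n → m · x ↭ n · x
  ·-cong x refl = ↭-refl

  ∈-·⁻ : ∀ n {x y} → x ∈ n · y → x ≡ y
  ∈-·⁻ (suc n) (here x≡y) = x≡y
  ∈-·⁻ (suc n) (there x∈) = ∈-·⁻ n x∈

  forth : ∀ {xs ys : List S} {x} → xs ↭ ys → x ∈ xs → x ∈ ys
  forth = ∈-resp-↭

  back : ∀ {xs ys : List S} {x} → xs ↭ ys → x ∈ ys → x ∈ xs
  back p = ∈-resp-↭ (↭-sym p)

  ∈-++[]⁻ : ∀ {xs : List S} {x} → x ∈ xs ++ [] → x ∈ xs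
  ∈-++[]⁻ {xs} x∈ with ∈-++⁻ xs x∈
  ... | inj₁ x∈xs = x∈xs
  ... | inj₂ ()

  ∈-·⁺ : ∀ {n} x → 1 ≤ n → x ∈ n · x
  ∈-·⁺ {suc n} x _ = here refl

  ∈-suc· : ∀ n x → x ∈ suc n · x
  ∈-suc· n x = here refl

  ∈-two : ∀ m a n b {x} → x ∈ m · a ++ n · b → x ≡ a ⊎ x ≡ b
  ∈-two m a n b x∈ with ∈-++⁻ (m · a) x∈
  ... | inj₁ x∈a = inj₁ (∈-·⁻ m x∈a)
  ... | inj₂ x∈b = inj₂ (∈-·⁻ n x∈b)

  ∈-three : ∀ l a m b n c {x} → x ∈ (l · a ++ m · b) ++ n · c → x ≡ a ⊎ x ≡ b ⊎ x ≡ c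
  ∈-three l a m b n c x∈ with ∈-++⁻ (l · a ++ m · b) x∈
  ... | inj₂ x∈c = inj₂ (inj₂ (∈-·⁻ n x∈c))
  ... | inj₁ x∈ab with ∈-two l a m b x∈ab
  ...   | inj₁ x≡a = inj₁ x≡a
  ...   | inj₂ x≡b = inj₂ (inj₁ x≡b)

  ++-cancelˡ : ∀ xs {ys zs : List S} → xs ++ ys ↭ xs ++ zs → ys ↭ zs
  ++-cancelˡ []       p = p
  ++-cancelˡ (x ∷ xs) p = ++-cancelˡ xs (drop-∷ p)

  ++-cancelʳ : ∀ zs {xs ys : List S} → xs ++ zs ↭ ys ++ zs → xs ↭ ys
  ++-cancelʳ zs {xs} {ys} p = ++-cancelˡ zs (++-comm zs xs ⨾ p ⨾ ++-comm ys zs)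

  ·-injective : ∀ {n x y} → 1 ≤ n → n · x ↭ n · y → x ≡ y
  ·-injective {suc n} _ p = ∈-·⁻ (suc n) (forth p (here refl))

  split-off : ∀ {x : S} {xs} → x ∈ xs → ∃ λ ys → xs ↭ x ∷ ys
  split-off {x} x∈ with ∈-∃++ x∈
  ... | as , bs , refl = as ++ bs , shift x as bs

  compare-blocks : ∀ a c {v : S} {xs ys} → xs ++ a · v ↭ ys ++ c · v →
                   (a ≡ c × xs ↭ ys) ⊎ v ∈ xs ⊎ v ∈ ys
  compare-blocks zero zero {xs = xs} {ys} p =
    inj₁ (refl , ↭-sym (++-identityʳ xs) ⨾ p ⨾ ++-identityʳ ys)
  compare-blocks (suc a) zero {xs = xs} {ys} p
    with ∈-++⁻ ys (forth p (∈-++⁺ʳ xs (here refl)))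
  ... | inj₁ v∈ys = inj₂ (inj₂ v∈ys)
  ... | inj₂ ()
  compare-blocks zero (suc c) {xs = xs} {ys} p
    with ∈-++⁻ xs (back p (∈-++⁺ʳ ys (here refl)))
  ... | inj₁ v∈xs = inj₂ (inj₁ v∈xs)
  ... | inj₂ ()
  compare-blocks (suc a) (suc c) {xs = xs} {ys} p
    with compare-blocks a c (drop-mid xs ys p)
  ... | inj₁ (a≡c , q) = inj₁ (cong suc a≡c , q)
  ... | inj₂ v∈    = inj₂ v∈

  exchange-sizes : ∀ {u v : S} r m → u ≢ v → r · u ++ m · v ↭ m · u ++ r · v → r ≡ m
  exchange-sizes {u} {v} r m u≢v p with compare-blocks m r p
  ... | inj₁ (m≡r , _)  = sym m≡r
  ... | inj₂ (inj₁ v∈) = ⊥-elim (u≢v (sym (∈-·⁻ r v∈)))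
  ... | inj₂ (inj₂ v∈) = ⊥-elim (u≢v (sym (∈-·⁻ m v∈)))

  record OnLeaf (e : List S) (r : ℕ) (q : List S) : Set where
    constructor on-leaf
    field
      coordinate : S
      equation   : q ↭ e ++ r · coordinate

  cross-cancel : ∀ (e e' a b c d : List S) → e ++ a ↭ e' ++ c → e ++ b ↭ e' ++ d → a ++ d ↭ c ++ b
  cross-cancel e e' a b c d p₁ p₂ = ++-cancelˡ (e ++ e')
    (↭-sym (interchange e a e' d) ⨾ ++⁺ p₁ (↭-sym p₂)
     ⨾ interchange e' c e b ⨾ ++⁺ʳ (c ++ b) (++-comm e' e))

  -- Adding the two
  -- equations crosswise gives r·u + r'·y = r'·x + r·v, whence u = x,
  -- v = y and then r = r' by exchange-sizes.
  leaf-rigidity : ∀ {e e' : List S} {r r' u v x y} → 1 ≤ r → u ≢ v →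
              e ++ r · u ↭ e' ++ r' · x → e ++ r · v ↭ e' ++ r' · y → e ↭ e' × r ≡ r'
  leaf-rigidity {e} {e'} {r} {r'} {u} {v} {x} {y} r≥1 u≢v p₁ p₂
    with ∈-two r' x r v (forth cross (∈-++⁺ˡ (∈-·⁺ u r≥1)))
       | ∈-two r u r' y (back cross (∈-++⁺ʳ (r' · x) (∈-·⁺ v r≥1)))
    where
    cross : r · u ++ r' · y ↭ r' · x ++ r · v
    cross = cross-cancel e e' _ _ _ _ p₁ p₂
  ... | inj₂ u≡v  | _         = ⊥-elim (u≢v u≡v)
  ... | _         | inj₁ v≡u  = ⊥-elim (u≢v (sym v≡u))
  ... | inj₁ refl | inj₂ refl
    with refl ← exchange-sizes r r' u≢v (cross-cancel e e' _ _ _ _ p₁ p₂)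
    = ++-cancelʳ (r · u) p₁ , refl

  -- e + r·a = e' + r'·a, with the surplus copies of a absorbed by e or e'.
  Shifted : List S → ℕ → List S → ℕ → S → Set
  Shifted e r e' r' a = (∃ λ j → r' ≡ r + j × e ↭ e' ++ j · a)
                      ⊎ (∃ λ j → r ≡ r' + j × e' ↭ e ++ j · a)

  shifted : ∀ e r a e' r' → e ++ r · a ↭ e' ++ r' · a → Shifted e r e' r' a
  shifted e r a e' r' p with ≤-total r r'
  ... | inj₁ r≤r' with j , refl ← m≤n⇒∃[o]m+o≡n r≤r' =
    inj₁ (j , refl , ++-cancelʳ (r · a)
      (p ⨾ ++⁺ˡ e' (↭-reflexive (·-+ r j a)) ⨾ swap-inner e' (r · a) (j · a)))
  ... | inj₂ r'≤r with j , refl ← m≤n⇒∃[o]m+o≡n r'≤r =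
    inj₂ (j , refl , ++-cancelʳ (r' · a)
      (↭-sym p ⨾ ++⁺ˡ e (↭-reflexive (·-+ r' j a)) ⨾ swap-inner e (r' · a) (j · a)))

  Exchange : List S → ℕ → S → List S → ℕ → S → Set
  Exchange e r a e' r' a' = (a ≡ a' × Shifted e r e' r' a)
                          ⊎ (∃ λ c → e ↭ c ++ r' · a' × e' ↭ c ++ r · a)

  -- By induction on r': the first copy of a' lies in r·a (then a = a') or
  -- in e, where it is split off.
  exchange : ∀ e r a e' r' a' → e ++ r · a ↭ e' ++ r' · a' → Exchange e r a e' r' a'
  exchange e r a e' zero a' p =
    inj₂ (e , ↭-sym (++-identityʳ e) , ↭-sym (++-identityʳ e') ⨾ ↭-sym p)
  exchange e r a e' (suc r') a' p
    with ∈-++⁻ e (back p (∈-++⁺ʳ e' (here refl)))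
  ... | inj₂ a'∈ra with refl ← ∈-·⁻ r a'∈ra = inj₁ (refl , shifted e r a e' (suc r') p)
  ... | inj₁ a'∈e with split-off a'∈e
  ... | e₀ , e↭ with exchange e₀ r a e' r' a'
                       (drop-∷ (↭-sym (++⁺ʳ (r · a) e↭) ⨾ p ⨾ shift a' e' (r' · a')))
  ... | inj₁ (refl , _)      = inj₁ (refl , shifted e r a e' (suc r') p)
  ... | inj₂ (c , e₀↭ , e'↭) = inj₂ (c , e↭ ⨾ prep a' e₀↭ ⨾ ↭-sym (shift a' c (r' · a')) , e'↭)

  -- q arises from w by exchanging one block: w = g + t·u and q = g + t·v.
  -- Collinear points of a Veronese space are related in this way.
  Adjacent : List S → List S → Set
  Adjacent q w = ∃ λ g → ∃ λ t → ∃ λ u → ∃ λ v → w ↭ g ++ t · u × q ↭ g ++ t · v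

  -- The non-degenerate ways in which q can be adjacent to e + r·b
  -- (all displayed blocks nonempty).
  data Shape (q e : List S) (r : ℕ) (b : S) : Set where
    -- q = e + m·b + n·v : some of the r copies of b are replaced by v
    inside   : ∀ m n v → suc m + suc n ≡ r →
               q ↭ e ++ (suc m · b ++ suc n · v) → Shape q e r b
    -- q + s·b = e + (s + r)·v : all r copies of b and s more are replaced by v
    overflow : ∀ s v → q ++ suc s · b ↭ e ++ (suc s + r) · v → Shape q e r b
    -- q + t·u = e + r·b + t·v : t copies of some u in e are replaced by v
    outside  : ∀ t u v → q ++ suc t · u ↭ e ++ (r · b ++ suc t · v) → Shape q e r b

  module _ {q e : List S} {r : ℕ} {b : S} where

    removed added : Shape q e r b → List S
    removed (inside _ _ _ _ _) = []
    removed (overflow s _ _)   = suc s · b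
    removed (outside t u _ _)  = suc t · u
    added (inside m n v _ _)   = suc m · b ++ suc n · v
    added (overflow s v _)     = (suc s + r) · v
    added (outside t _ v _)    = r · b ++ suc t · v

    balance : (f : Shape q e r b) → q ++ removed f ↭ e ++ added f
    balance (inside _ _ _ _ h) = ++-identityʳ q ⨾ h
    balance (overflow _ _ h)   = h
    balance (outside _ _ _ h)  = h

  module _ {q e : List S} {r : ℕ} where

    inside-leaf : ∀ b m n → m + n ≡ r → q ↭ e ++ (m · b ++ n · b) → OnLeaf e r q
    inside-leaf b m n refl h = on-leaf b (h ⨾ ++⁺ˡ e (↭-reflexive (sym (·-+ m n b))))

    overflow-leaf : ∀ b s v → v ≡ b → q ++ s · b ↭ e ++ (s + r) · v → OnLeaf e r q
    overflow-leaf b s _ refl h = on-leaf b (++-cancelʳ (s · b)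
      (h ⨾ ++⁺ˡ e (↭-reflexive (·-+ s r b)) ⨾ swap-inner e (s · b) (r · b)))

    outside-leaf : ∀ b t u v → u ≡ v → q ++ t · u ↭ e ++ (r · b ++ t · v) → OnLeaf e r q
    outside-leaf b t _ v refl h =
      on-leaf b (++-cancelʳ (t · v) (h ⨾ ↭-sym (++-assoc e (r · b) (t · v))))

    outside-full : ∀ b t v → t ≡ r → q ++ t · b ↭ e ++ (r · b ++ t · v) → OnLeaf e r q
    outside-full b t v refl h = on-leaf v (++-cancelʳ (t · b) (h ⨾ swap-inner e (t · b) (t · v)))

  compare-shapes : ∀ {q e r b b'} (f : Shape q e r b) (f' : Shape q e r b') →
                   added f ++ removed f' ↭ added f' ++ removed f
  compare-shapes {q} {e} f f' =
    ↭-sym (cross-cancel q e _ _ _ _ (balance f) (balance f')) ⨾ ++-comm (removed f) (added f')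

  module _ {q e : List S} {r : ℕ} {b : S} where

    inside-or-leaf : ∀ m n v → m + n ≡ r → q ↭ e ++ (m · b ++ n · v) →
                     OnLeaf e r q ⊎ Shape q e r b
    inside-or-leaf zero    n       v refl h = inj₁ (on-leaf v h)
    inside-or-leaf (suc m) zero    v eq   h = inj₁ (inside-leaf b (suc m) zero eq h)
    inside-or-leaf (suc m) (suc n) v eq   h = inj₂ (inside m n v eq h)

    overflow-or-leaf : ∀ s v → q ++ s · b ↭ e ++ (s + r) · v → OnLeaf e r q ⊎ Shape q e r b
    overflow-or-leaf zero    v h = inj₁ (on-leaf v (↭-sym (++-identityʳ q) ⨾ h))
    overflow-or-leaf (suc s) v h = inj₂ (overflow s v h)

    outside-or-leaf : ∀ t u v → q ++ t · u ↭ e ++ (r · b ++ t · v) → OnLeaf e r q ⊎ Shape q e r b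
    outside-or-leaf zero    u v h =
      inj₁ (on-leaf b (↭-sym (++-identityʳ q) ⨾ h ⨾ ++⁺ˡ e (++-identityʳ (r · b))))
    outside-or-leaf (suc t) u v h = inj₂ (outside t u v h)

    shape : Adjacent q (e ++ r · b) → OnLeaf e r q ⊎ Shape q e r b
    shape (g , t , u , v , h₁ , h₂) with exchange e r b g t u h₁
    ... | inj₁ (refl , inj₁ (j , refl , k)) = overflow-or-leaf j v
            (++⁺ʳ (j · b) h₂ ⨾ swap-last g ((r + j) · v) (j · b)
             ⨾ ++⁺ (↭-sym k) (·-cong v (+-comm r j)))
    ... | inj₁ (refl , inj₂ (j , refl , k)) = inside-or-leaf j t v (+-comm j t)
            (h₂ ⨾ ++⁺ʳ (t · v) k ⨾ ++-assoc e (j · b) (t · v))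
    ... | inj₂ (c , k₁ , k₂) = outside-or-leaf t u v
            (++⁺ʳ (t · u) (h₂ ⨾ ++⁺ʳ (t · v) k₂) ⨾ regroup c (r · b) (t · v) (t · u)
             ⨾ ++⁺ʳ (r · b ++ t · v) (↭-sym k₁))

  -- The elements b' ≠ b for which q may also have a shape relative to
  -- e + r·b', given its shape relative to e + r·b.
  Candidate : ∀ {q e r b} → Shape q e r b → S → Set
  Candidate (inside _ _ v _ _)           b' = v ≡ b'
  Candidate (overflow _ v _)             b' = v ≡ b'
  Candidate {b = b} (outside _ u v _)    b' = v ≡ b' ⊎ (u ≡ b' × v ≡ b)

  module _ {q e : List S} {r : ℕ} {b b' : S} (r≥1 : 1 ≤ r) (b≢b' : b ≢ b') where

    inside-candidates : ∀ m n v → suc m + suc n ≡ r → q ↭ e ++ (suc m · b ++ suc n · v) →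
      (f' : Shape q e r b') → (suc m · b ++ suc n · v) ++ removed f' ↭ added f' ++ [] →
      OnLeaf e r q ⊎ v ≡ b'
    inside-candidates m n v eq h (inside m' n' v' _ _) E
      with ∈-two (suc m) b (suc n) v (∈-++[]⁻ (back E (∈-++⁺ˡ (∈-++⁺ˡ (∈-suc· m' b')))))
    ... | inj₁ b'≡b = ⊥-elim (b≢b' (sym b'≡b))
    ... | inj₂ b'≡v = inj₂ (sym b'≡v)
    inside-candidates m n v eq h (overflow s' v' _) E
      with refl ← ∈-·⁻ (suc s' + r) (∈-++[]⁻ (forth E (∈-++⁺ˡ (∈-++⁺ˡ (∈-suc· m b)))))
         | refl ← ∈-·⁻ (suc s' + r) (∈-++[]⁻ (forth E (∈-++⁺ˡ (∈-++⁺ʳ (suc m · b) (∈-suc· n v)))))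
      = inj₁ (inside-leaf b (suc m) (suc n) eq h)
    inside-candidates m n v eq h (outside t' u' v' _) E
      with ∈-two r b' (suc t') v' (∈-++[]⁻ (forth E (∈-++⁺ˡ (∈-++⁺ʳ (suc m · b) (∈-suc· n v)))))
    ... | inj₁ v≡b' = inj₂ v≡b'
    ... | inj₂ refl
      with ∈-two r b' (suc t') v (∈-++[]⁻ (forth E (∈-++⁺ˡ (∈-++⁺ˡ (∈-suc· m b)))))
    ... | inj₁ b≡b' = ⊥-elim (b≢b' b≡b')
    ... | inj₂ refl = inj₁ (inside-leaf b (suc m) (suc n) eq h)

    overflow-candidates : ∀ s v → q ++ suc s · b ↭ e ++ (suc s + r) · v →
      (f' : Shape q e r b') → (suc s + r) · v ++ removed f' ↭ added f' ++ suc s · b →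
      OnLeaf e r q ⊎ v ≡ b'
    overflow-candidates s v h f' E
      with ∈-++⁻ ((suc s + r) · v) (back E (∈-++⁺ʳ (added f') (∈-suc· s b)))
    ... | inj₁ b∈v = inj₁ (overflow-leaf b (suc s) v (sym (∈-·⁻ (suc s + r) b∈v)) h)
    overflow-candidates s v h (overflow s' v' _) E | inj₂ b∈b' =
      ⊥-elim (b≢b' (∈-·⁻ (suc s') b∈b'))
    overflow-candidates s v h (outside t' u' v' _) E | inj₂ b∈u'
      with refl ← ∈-·⁻ (suc t') b∈u'
         | ∈-two (suc s + r) v (suc t') b (back E (∈-++⁺ˡ (∈-++⁺ˡ (∈-·⁺ b' r≥1))))
    ... | inj₁ b'≡v = inj₂ (sym b'≡v)
    ... | inj₂ b'≡b = ⊥-elim (b≢b' (sym b'≡b))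

    outside-swapped : ∀ t t' v → q ++ suc t · b ↭ e ++ (r · b ++ suc t · v) →
      (r · b ++ suc t · v) ++ suc t' · b' ↭ (r · b' ++ suc t' · v) ++ suc t · b →
      OnLeaf e r q ⊎ v ≡ b'
    outside-swapped t t' v h E
      with compare-blocks (suc t) (suc t')
             (↭-sym (swap-last (r · b) (suc t · v) (suc t' · b')) ⨾ E
              ⨾ swap-last (r · b') (suc t' · v) (suc t · b))
    ... | inj₁ (refl , rest) = inj₁ (outside-full b (suc t) v (sym r≡t) h)
      where
      r≡t : r ≡ suc t
      r≡t = exchange-sizes r (suc t) b≢b' (rest ⨾ ++-comm (r · b') (suc t · b))
    ... | inj₂ (inj₁ v∈) with ∈-two r b (suc t') b' v∈
    ...   | inj₁ v≡b  = inj₁ (outside-leaf b (suc t) b v (sym v≡b) h)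
    ...   | inj₂ v≡b' = inj₂ v≡b'
    outside-swapped t t' v h E | inj₂ (inj₂ v∈) with ∈-two r b' (suc t) b v∈
    ...   | inj₁ v≡b' = inj₂ v≡b'
    ...   | inj₂ v≡b  = inj₁ (outside-leaf b (suc t) b v (sym v≡b) h)

    -- Chasing v, b' and b through the
    -- comparison either settles the claim or forces v' = v, u' = b' and
    -- u = b (then outside-swapped applies) or v = b (then u is read off).
    outside-outside : ∀ t u v t' u' v' →
      q ++ suc t · u ↭ e ++ (r · b ++ suc t · v) →
      (r · b ++ suc t · v) ++ suc t' · u' ↭ (r · b' ++ suc t' · v') ++ suc t · u →
      OnLeaf e r q ⊎ (v ≡ b' ⊎ (u ≡ b' × v ≡ b))
    outside-outside t u v t' u' v' h E
      with ∈-three r b' (suc t') v' (suc t) u (forth E (∈-++⁺ˡ (∈-++⁺ʳ (r · b) (∈-suc· t v))))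
    ... | inj₁ v≡b'         = inj₂ (inj₁ v≡b')
    ... | inj₂ (inj₂ v≡u)   = inj₁ (outside-leaf b (suc t) u v (sym v≡u) h)
    ... | inj₂ (inj₁ refl)
      with ∈-three r b (suc t) v (suc t') u' (back E (∈-++⁺ˡ (∈-++⁺ˡ (∈-·⁺ b' r≥1))))
    ... | inj₁ b'≡b         = ⊥-elim (b≢b' (sym b'≡b))
    ... | inj₂ (inj₁ b'≡v)  = inj₂ (inj₁ (sym b'≡v))
    ... | inj₂ (inj₂ refl)
      with ∈-three r b' (suc t') v (suc t) u (forth E (∈-++⁺ˡ (∈-++⁺ˡ (∈-·⁺ b r≥1))))
    ... | inj₁ b≡b'         = ⊥-elim (b≢b' b≡b')
    ... | inj₂ (inj₂ refl)  = map₂ inj₁ (outside-swapped t t' v h E)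
    ... | inj₂ (inj₁ refl)
      with ∈-three r b (suc t) b (suc t') b' (back E (∈-++⁺ʳ (r · b' ++ suc t' · b) (∈-suc· t u)))
    ... | inj₁ u≡b          = inj₁ (outside-leaf b (suc t) u b u≡b h)
    ... | inj₂ (inj₁ u≡b)   = inj₁ (outside-leaf b (suc t) u b u≡b h)
    ... | inj₂ (inj₂ u≡b')  = inj₂ (inj₂ (u≡b' , refl))

    outside-candidates : ∀ t u v → q ++ suc t · u ↭ e ++ (r · b ++ suc t · v) →
      (f' : Shape q e r b') → (r · b ++ suc t · v) ++ removed f' ↭ added f' ++ suc t · u →
      OnLeaf e r q ⊎ (v ≡ b' ⊎ (u ≡ b' × v ≡ b))
    outside-candidates t u v h (inside m' n' v' _ _) E
      with ∈-two r b (suc t) v (∈-++[]⁻ (back E (∈-++⁺ˡ (∈-++⁺ˡ (∈-suc· m' b')))))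
    ... | inj₁ b'≡b = ⊥-elim (b≢b' (sym b'≡b))
    ... | inj₂ b'≡v = inj₂ (inj₁ (sym b'≡v))
    outside-candidates t u v h (overflow s' v' h') E
      with ∈-two (suc s' + r) v' (suc t) u (forth E (∈-++⁺ʳ (r · b ++ suc t · v) (∈-suc· s' b')))
    ... | inj₁ b'≡v' = inj₁ (overflow-leaf b' (suc s') v' (sym b'≡v') h')
    ... | inj₂ refl
      with ∈-two (suc s' + r) v' (suc t) b' (forth E (∈-++⁺ˡ (∈-++⁺ʳ (r · b) (∈-suc· t v))))
    ... | inj₂ v≡b' = inj₂ (inj₁ v≡b')
    ... | inj₁ v≡v'
      with ∈-two (suc s' + r) v' (suc t) b' (forth E (∈-++⁺ˡ (∈-++⁺ˡ (∈-·⁺ b r≥1))))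
    ... | inj₁ b≡v' = inj₂ (inj₂ (refl , trans v≡v' (sym b≡v')))
    ... | inj₂ b≡b' = ⊥-elim (b≢b' b≡b')
    outside-candidates t u v h (outside t' u' v' _) E = outside-outside t u v t' u' v' h E

    candidates : (f : Shape q e r b) (f' : Shape q e r b') → OnLeaf e r q ⊎ Candidate f b'
    candidates f@(inside m n v eq h) f' = inside-candidates m n v eq h f' (compare-shapes f f')
    candidates f@(overflow s v h)    f' = overflow-candidates s v h f' (compare-shapes f f')
    candidates f@(outside t u v h)   f' = outside-candidates t u v h f' (compare-shapes f f')

  candidates-agree : ∀ {q e r b b₂ b₃} (f : Shape q e r b) → b ≢ b₂ → b ≢ b₃ →
                     Candidate f b₂ → Candidate f b₃ → b₂ ≡ b₃
  candidates-agree (inside _ _ _ _ _) _ _ v≡b₂ v≡b₃ = trans (sym v≡b₂) v≡b₃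
  candidates-agree (overflow _ _ _)   _ _ v≡b₂ v≡b₃ = trans (sym v≡b₂) v≡b₃
  candidates-agree (outside _ _ _ _) b≢b₂ b≢b₃ c₂ c₃ with c₂ | c₃
  ... | inj₁ v≡b₂        | inj₁ v≡b₃        = trans (sym v≡b₂) v≡b₃
  ... | inj₁ v≡b₂        | inj₂ (_ , v≡b)   = ⊥-elim (b≢b₂ (trans (sym v≡b) v≡b₂))
  ... | inj₂ (_ , v≡b)   | inj₁ v≡b₃        = ⊥-elim (b≢b₃ (trans (sym v≡b) v≡b₃))
  ... | inj₂ (u≡b₂ , _)  | inj₂ (u≡b₃ , _)  = trans (sym u≡b₂) u≡b₃

  three-points : ∀ {q e r b₁ b₂ b₃} → 1 ≤ r → b₁ ≢ b₂ → b₁ ≢ b₃ →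
    Adjacent q (e ++ r · b₁) → Adjacent q (e ++ r · b₂) → Adjacent q (e ++ r · b₃) →
    OnLeaf e r q ⊎ b₂ ≡ b₃
  three-points r≥1 b₁≢b₂ b₁≢b₃ a₁ a₂ a₃ with shape a₁ | shape a₂ | shape a₃
  ... | inj₁ leaf | _ | _ = inj₁ leaf
  ... | inj₂ _ | inj₁ leaf | _ = inj₁ leaf
  ... | inj₂ _ | inj₂ _ | inj₁ leaf = inj₁ leaf
  ... | inj₂ f₁ | inj₂ f₂ | inj₂ f₃
    with candidates r≥1 b₁≢b₂ f₁ f₂ | candidates r≥1 b₁≢b₃ f₁ f₃
  ... | inj₁ leaf | _ = inj₁ leaf
  ... | inj₂ _ | inj₁ leaf = inj₁ leaf
  ... | inj₂ c₂ | inj₂ c₃ = inj₂ (candidates-agree f₁ b₁≢b₂ b₁≢b₃ c₂ c₃)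

swap-second-pair : ∀ (G : Incidence) p L₁ L₂ M₁ M₂ →
                   IncVeblen G p L₁ L₂ M₁ M₂ → IncVeblen G p L₁ L₂ M₂ M₁
swap-second-pair G _ _ _ _ _ (pL₁ , pL₂ , p∉M₁ , p∉M₂ , L₁≠L₂ , M₁≠M₂ , m₁₁ , m₁₂ , m₂₁ , m₂₂) =
  pL₁ , pL₂ , p∉M₂ , p∉M₁ , L₁≠L₂ , (λ same → M₁≠M₂ (λ x → swap (same x))) , m₁₂ , m₁₁ , m₂₂ , m₂₁

module VeroneseGeometry (𝔐 : PartialLinearSpace) (k : ℕ) where
  open PartialLinearSpace 𝔐
  open Veronese 𝔐 k
  open Multisets {S}

  ⟨_⟩ : VPoint → List S
  ⟨ q ⟩ = proj₁ q

  _≃_ : VPoint → VPoint → Set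
  q ≃ w = ⟨ q ⟩ ↭ ⟨ w ⟩

  base : VLine → List S
  base = VLine.e

  mult : VLine → ℕ
  mult = VLine.r

  record SameLeaf (ℓ m : VLine) : Set where
    constructor same-leaf-as
    field
      same-base : base ℓ ↭ base m
      same-mult : mult ℓ ≡ mult m

  SameLeaf-refl : ∀ {ℓ} → SameLeaf ℓ ℓ
  SameLeaf-refl = same-leaf-as ↭-refl refl

  SameLeaf-sym : ∀ {ℓ m} → SameLeaf ℓ m → SameLeaf m ℓ
  SameLeaf-sym (same-leaf-as e↭ r≡) = same-leaf-as (↭-sym e↭) (sym r≡)

  SameLeaf-trans : ∀ {ℓ m n} → SameLeaf ℓ m → SameLeaf m n → SameLeaf ℓ n
  SameLeaf-trans (same-leaf-as e↭ r≡) (same-leaf-as e↭' r≡') =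
    same-leaf-as (e↭ ⨾ e↭') (trans r≡ r≡')

  leaf-point : ∀ {ℓ m} → SameLeaf ℓ m → ∀ z → base ℓ ++ mult ℓ · z ↭ base m ++ mult m · z
  leaf-point (same-leaf-as e↭ r≡) z = ++⁺ e↭ (·-cong z r≡)

  on-resp : ∀ q w ℓ → q ≃ w → q onV ℓ → w onV ℓ
  on-resp _ _ _ q≃w (x , Lx , h) = x , Lx , ↭-sym q≃w ⨾ h

  off-line : ∀ p w m → ¬ (p onV m) → w onV m → ¬ p ≃ w
  off-line p w m p∉m w∈m p≃w = p∉m (on-resp w p m (↭-sym p≃w) w∈m)

  on-leaf-of : ∀ q ℓ → q onV ℓ → OnLeaf (base ℓ) (mult ℓ) ⟨ q ⟩
  on-leaf-of _ _ (x , _ , h) = on-leaf x h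

  on-leaf-of′ : ∀ q ℓ m → SameLeaf ℓ m → q onV ℓ → OnLeaf (base m) (mult m) ⟨ q ⟩
  on-leaf-of′ _ _ _ same (x , _ , h) = on-leaf x (h ⨾ leaf-point same x)

  same-coordinate : ∀ q w ℓ (hq : q onV ℓ) (hw : w onV ℓ) → proj₁ hq ≡ proj₁ hw → q ≃ w
  same-coordinate _ _ _ (_ , _ , hq) (_ , _ , hw) refl = hq ⨾ ↭-sym hw

  coordinates-differ : ∀ q w ℓ (hq : q onV ℓ) (hw : w onV ℓ) → ¬ q ≃ w → proj₁ hq ≢ proj₁ hw
  coordinates-differ q w ℓ hq hw q≄w x≡y = q≄w (same-coordinate q w ℓ hq hw x≡y)

  coordinates-agree : ∀ q ℓ m → SameLeaf ℓ m → (hℓ : q onV ℓ) (hm : q onV m) →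
                      proj₁ hℓ ≡ proj₁ hm
  coordinates-agree _ ℓ m same (x , _ , hx) (y , _ , hy) =
    ·-injective (VLine.pos m) (++-cancelˡ (base m) (↭-sym (leaf-point same x) ⨾ ↭-sym hx ⨾ hy))

  coordinate-on : ∀ q ℓ m → SameLeaf ℓ m → (hℓ : q onV ℓ) → q onV m → L (VLine.i m) (proj₁ hℓ)
  coordinate-on q ℓ m same hℓ hm@(_ , Ly , _) =
    subst (L (VLine.i m)) (sym (coordinates-agree q ℓ m same hℓ hm)) Ly

  rigid : ∀ q w m ℓ → q onV m → w onV m → ¬ q ≃ w →
          OnLeaf (base ℓ) (mult ℓ) ⟨ q ⟩ → OnLeaf (base ℓ) (mult ℓ) ⟨ w ⟩ → SameLeaf m ℓ
  rigid q w m ℓ hq@(_ , _ , hx) hw@(_ , _ , hy) q≄w (on-leaf _ eq) (on-leaf _ ew) =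
    let (e↭ , r≡) = leaf-rigidity (VLine.pos m) (coordinates-differ q w m hq hw q≄w)
                              (↭-sym hx ⨾ eq) (↭-sym hy ⨾ ew)
    in same-leaf-as e↭ r≡

  line-transfer : ∀ ℓ m → SameLeaf ℓ m → SameLine asIncidence (VLine.i ℓ) (VLine.i m) →
                  SameLine V ℓ m
  line-transfer ℓ m same same-S _ =
      (λ (x , Lx , h) → x , proj₁ (same-S x) Lx , h ⨾ leaf-point same x)
    , (λ (x , Lx , h) → x , proj₂ (same-S x) Lx , h ⨾ ↭-sym (leaf-point same x))

  -- Two lines through two distinct points coincide: they lie in a common
  -- leaf by rigidity, and their lines in 𝔐 share two points.
  same-line : ∀ q w ℓ m → q onV ℓ → w onV ℓ → q onV m → w onV m → ¬ q ≃ w → SameLine V ℓ m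
  same-line q w ℓ m qℓ wℓ qm wm q≄w = line-transfer ℓ m same same-S
    where
    same : SameLeaf ℓ m
    same = rigid q w ℓ m qℓ wℓ q≄w (on-leaf-of q m qm) (on-leaf-of w m wm)
    same-S : SameLine asIncidence (VLine.i ℓ) (VLine.i m)
    same-S = unique (VLine.i ℓ) (VLine.i m) (proj₁ qℓ) (proj₁ wℓ)
               (coordinates-differ q w ℓ qℓ wℓ q≄w) (proj₁ (proj₂ qℓ)) (proj₁ (proj₂ wℓ))
               (coordinate-on q ℓ m same qℓ qm) (coordinate-on w ℓ m same wℓ wm)

  adjacent : ∀ q w → Collinear V q w → Adjacent ⟨ q ⟩ ⟨ w ⟩
  adjacent _ _ (n , (x , _ , hq) , (y , _ , hw)) = base n , mult n , y , x , hw , hq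

  adjacent-to : ∀ {q w w'} → w ↭ w' → Adjacent q w → Adjacent q w'
  adjacent-to w↭w' (g , t , u , v , hw , hq) = g , t , u , v , ↭-sym w↭w' ⨾ hw , hq

  -- Let q ≠ p lie on a line ℓ' through p, and let q be
  -- collinear with two points w₁, w₂ ≠ p of another line ℓ through p.  By
  -- the three-point lemma (applied to p, w₁, w₂ on ℓ) either q lies in the
  -- leaf of ℓ, and then so does ℓ' by rigidity, or w₁ = w₂.
  pivot : ∀ p q w₁ w₂ ℓ ℓ' → p onV ℓ → w₁ onV ℓ → w₂ onV ℓ → p onV ℓ' → q onV ℓ' →
          ¬ p ≃ w₁ → ¬ p ≃ w₂ → ¬ p ≃ q → Collinear V q w₁ → Collinear V q w₂ →
          SameLeaf ℓ' ℓ ⊎ w₁ ≃ w₂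
  pivot p q w₁ w₂ ℓ ℓ' pℓ w₁ℓ w₂ℓ pℓ' qℓ' p≄w₁ p≄w₂ p≄q qw₁ qw₂
    with three-points (VLine.pos ℓ)
           (coordinates-differ p w₁ ℓ pℓ w₁ℓ p≄w₁) (coordinates-differ p w₂ ℓ pℓ w₂ℓ p≄w₂)
           (adjacent-to (proj₂ (proj₂ pℓ)) (adjacent q p (ℓ' , qℓ' , pℓ')))
           (adjacent-to (proj₂ (proj₂ w₁ℓ)) (adjacent q w₁ qw₁))
           (adjacent-to (proj₂ (proj₂ w₂ℓ)) (adjacent q w₂ qw₂))
  ... | inj₁ q-in-leaf = inj₁ (rigid p q ℓ' ℓ pℓ' qℓ' p≄q (on-leaf-of p ℓ pℓ) q-in-leaf)
  ... | inj₂ x₁≡x₂ = inj₂ (same-coordinate w₁ w₂ ℓ w₁ℓ w₂ℓ x₁≡x₂)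

  -- The pivot step at L₁∩M₁
  -- (w.r.t. L₂) either succeeds or gives L₂∩M₁ = L₂∩M₂; then the pivot
  -- step at L₂∩M₁ (w.r.t. L₁) either succeeds or gives L₁∩M₁ = L₁∩M₂, and
  -- M₁, M₂ would share the two distinct points L₁∩M₁ and L₂∩M₁.
  lines-through-p-same-leaf : ∀ p L₁ L₂ M₁ M₂ → IncVeblen V p L₁ L₂ M₁ M₂ →
                              CrossCollinear L₁ M₁ L₂ M₂ → SameLeaf L₁ L₂
  lines-through-p-same-leaf p L₁ L₂ M₁ M₂
    (pL₁ , pL₂ , p∉M₁ , p∉M₂ , L₁≠L₂ , M₁≠M₂ , _
          , (q₁₂ , q₁₂L₁ , q₁₂M₂) , (q₂₁ , q₂₁L₂ , q₂₁M₁) , _)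
    (q₁₁ , q₂₂ , q₁₁L₁ , q₁₁M₁ , q₂₂L₂ , q₂₂M₂ , q₁₁q₂₂) =
    case pivot p q₁₁ q₂₁ q₂₂ L₂ L₁ pL₂ q₂₁L₂ q₂₂L₂ pL₁ q₁₁L₁ p≄q₂₁ p≄q₂₂ p≄q₁₁
           (M₁ , q₁₁M₁ , q₂₁M₁) q₁₁q₂₂ of λ where
      (inj₁ L₁~L₂)   → L₁~L₂
      (inj₂ q₂₁≃q₂₂) →
        case pivot p q₂₁ q₁₁ q₁₂ L₁ L₂ pL₁ q₁₁L₁ q₁₂L₁ pL₂ q₂₁L₂ p≄q₁₁ p≄q₁₂ p≄q₂₁
               (M₁ , q₂₁M₁ , q₁₁M₁) (M₂ , q₂₁-on-M₂ q₂₁≃q₂₂ , q₁₂M₂) of λ where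
          (inj₁ L₂~L₁)   → SameLeaf-sym L₂~L₁
          (inj₂ q₁₁≃q₁₂) → ⊥-elim (M₁≠M₂ (same-line q₁₁ q₂₁ M₁ M₂ q₁₁M₁ q₂₁M₁
                             (on-resp q₁₂ q₁₁ M₂ (↭-sym q₁₁≃q₁₂) q₁₂M₂)
                             (q₂₁-on-M₂ q₂₁≃q₂₂) q₁₁≄q₂₁))
    where
    p≄q₁₁ : ¬ p ≃ q₁₁
    p≄q₁₁ = off-line p q₁₁ M₁ p∉M₁ q₁₁M₁
    p≄q₁₂ : ¬ p ≃ q₁₂
    p≄q₁₂ = off-line p q₁₂ M₂ p∉M₂ q₁₂M₂
    p≄q₂₁ : ¬ p ≃ q₂₁
    p≄q₂₁ = off-line p q₂₁ M₁ p∉M₁ q₂₁M₁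
    p≄q₂₂ : ¬ p ≃ q₂₂
    p≄q₂₂ = off-line p q₂₂ M₂ p∉M₂ q₂₂M₂

    q₂₁-on-M₂ : q₂₁ ≃ q₂₂ → q₂₁ onV M₂
    q₂₁-on-M₂ q₂₁≃q₂₂ = on-resp q₂₂ q₂₁ M₂ (↭-sym q₂₁≃q₂₂) q₂₂M₂

    -- otherwise q₂₁ would lie on L₁, and L₁, L₂ would share p and q₂₁
    q₁₁≄q₂₁ : ¬ q₁₁ ≃ q₂₁
    q₁₁≄q₂₁ q₁₁≃q₂₁ =
      L₁≠L₂ (same-line p q₂₁ L₁ L₂ pL₁ (on-resp q₁₁ q₂₁ L₁ q₁₁≃q₂₁ q₁₁L₁) pL₂ q₂₁L₂ p≄q₂₁)

  -- A line m ∌ p meeting two distinct lines ℓ, ℓ' through p of a common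
  -- leaf lies in that leaf: the two meeting points are distinct points of m
  -- in the leaf.
  transversal : ∀ p ℓ ℓ' m → SameLeaf ℓ' ℓ → ¬ SameLine V ℓ ℓ' → p onV ℓ → p onV ℓ' →
                ¬ (p onV m) → Meet V ℓ m → Meet V ℓ' m → SameLeaf m ℓ
  transversal p ℓ ℓ' m ℓ'~ℓ ℓ≠ℓ' pℓ pℓ' p∉m (w , wℓ , wm) (w' , w'ℓ' , w'm) =
    rigid w w' m ℓ wm w'm w≄w' (on-leaf-of w ℓ wℓ) (on-leaf-of′ w' ℓ' ℓ ℓ'~ℓ w'ℓ')
    where
    w≄w' : ¬ w ≃ w'
    w≄w' w≃w' = ℓ≠ℓ' (same-line p w' ℓ ℓ' pℓ (on-resp w w' ℓ w≃w' wℓ) pℓ' w'ℓ'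
                       (off-line p w' m p∉m w'm))

  configuration-in-leaf : ∀ p L₁ L₂ M₁ M₂ → IncVeblen V p L₁ L₂ M₁ M₂ →
    CrossCollinear L₁ M₁ L₂ M₂ ⊎ CrossCollinear L₁ M₂ L₂ M₁ →
    SameLeaf L₂ L₁ × SameLeaf M₁ L₁ × SameLeaf M₂ L₁
  configuration-in-leaf p L₁ L₂ M₁ M₂
    conf@(pL₁ , pL₂ , p∉M₁ , p∉M₂ , L₁≠L₂ , _ , m₁₁ , m₁₂ , m₂₁ , m₂₂) cross =
      L₂~L₁
    , transversal p L₁ L₂ M₁ L₂~L₁ L₁≠L₂ pL₁ pL₂ p∉M₁ m₁₁ m₂₁
    , transversal p L₁ L₂ M₂ L₂~L₁ L₁≠L₂ pL₁ pL₂ p∉M₂ m₁₂ m₂₂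
    where
    L₂~L₁ : SameLeaf L₂ L₁
    L₂~L₁ = SameLeaf-sym
      ([ lines-through-p-same-leaf p L₁ L₂ M₁ M₂ conf
       , lines-through-p-same-leaf p L₁ L₂ M₂ M₁ (swap-second-pair V p L₁ L₂ M₁ M₂ conf)
       ] cross)

  free-mult : ∀ ℓ → k ∸ length (base ℓ) ≡ mult ℓ
  free-mult ℓ = subst (λ n → n ∸ length (base ℓ) ≡ mult ℓ) (VLine.len ℓ)
                      (m+n∸m≡n (length (base ℓ)) (mult ℓ))

  base-short : ∀ ℓ → length (base ℓ) < k
  base-short ℓ = subst (length (base ℓ) <_) (VLine.len ℓ) (m<m+n (length (base ℓ)) (VLine.pos ℓ))

  line-in-leaf : ∀ m ℓ → SameLeaf m ℓ → LineInLeaf m (base ℓ)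
  line-in-leaf m ℓ m~ℓ _ (x , _ , h) =
    x , h ⨾ leaf-point m~ℓ x ⨾ ++⁺ˡ (base ℓ) (·-cong x (sym (free-mult ℓ)))

  -- The leaf of ℓ₀ is a copy of 𝔐: z ↦ base ℓ₀ + mult ℓ₀ · z, with the lines
  -- of that leaf corresponding to the lines of 𝔐.
  module LeafCopy (ℓ₀ : VLine) where

    above : S → VPoint
    above z = base ℓ₀ ++ mult ℓ₀ · z
            , trans (length-++ (base ℓ₀))
                    (trans (cong (length (base ℓ₀) +_) (length-replicate (mult ℓ₀))) (VLine.len ℓ₀))

    lift : ∀ m → SameLeaf m ℓ₀ → ∀ z → L (VLine.i m) z → above z onV m
    lift m m~ z Lz = z , Lz , ↭-sym (leaf-point m~ z)

    project-meet : ∀ m n → SameLeaf m ℓ₀ → SameLeaf n ℓ₀ → Meet V m n →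
                   Meet asIncidence (VLine.i m) (VLine.i n)
    project-meet m n m~ n~ (q , qm , qn) =
      proj₁ qm , proj₁ (proj₂ qm) , coordinate-on q m n (SameLeaf-trans m~ (SameLeaf-sym n~)) qm qn

  -- If 𝔐 is veblenian, a configuration lying in the leaf of L₁ is closed:
  -- it is the image of a configuration of 𝔐.
  veblen-in-leaf : ∀ p L₁ L₂ M₁ M₂ → IncVeblen V p L₁ L₂ M₁ M₂ →
    SameLeaf L₂ L₁ × SameLeaf M₁ L₁ × SameLeaf M₂ L₁ → Veblenian asIncidence → Meet V M₁ M₂
  veblen-in-leaf p L₁ L₂ M₁ M₂
    (pL₁ , pL₂ , p∉M₁ , p∉M₂ , L₁≠L₂ , M₁≠M₂ , m₁₁ , m₁₂ , m₂₁ , m₂₂) (L₂~ , M₁~ , M₂~) veblenian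
    with veblenian a (VLine.i L₁) (VLine.i L₂) (VLine.i M₁) (VLine.i M₂)
           ( proj₁ (proj₂ pL₁)
           , coordinate-on p L₁ L₂ (SameLeaf-sym L₂~) pL₁ pL₂
           , a∉ M₁ M₁~ p∉M₁ , a∉ M₂ M₂~ p∉M₂
           , (λ same → L₁≠L₂ (line-transfer L₁ L₂ (SameLeaf-sym L₂~) same))
           , (λ same → M₁≠M₂ (line-transfer M₁ M₂ (SameLeaf-trans M₁~ (SameLeaf-sym M₂~)) same))
           , project-meet L₁ M₁ SameLeaf-refl M₁~ m₁₁ , project-meet L₁ M₂ SameLeaf-refl M₂~ m₁₂
           , project-meet L₂ M₁ L₂~ M₁~ m₂₁ , project-meet L₂ M₂ L₂~ M₂~ m₂₂ )
    where
    open LeafCopy L₁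
    a : S
    a = proj₁ pL₁
    a∉ : ∀ m → SameLeaf m L₁ → ¬ (p onV m) → ¬ L (VLine.i m) a
    a∉ m m~ p∉m La = p∉m (on-resp (above a) p m (↭-sym (proj₂ (proj₂ pL₁))) (lift m m~ a La))
  ... | z , zM₁ , zM₂ = above z , lift M₁ M₁~ z zM₁ , lift M₂ M₂~ z zM₂
    where open LeafCopy L₁

-- All four lines lie in the leaf of L₁, whose base is shorter than k; the
-- veblenian consequence is then read off inside that leaf.
lemma1p7 : (M : PartialLinearSpace) (k : ℕ) → 1 ≤ k →
    (p : Veronese.VPoint M k) (L₁ L₂ M₁ M₂ : Veronese.VLine M k) →
    IncVeblen (Veronese.V M k) p L₁ L₂ M₁ M₂ →
    (Veronese.CrossCollinear M k L₁ M₁ L₂ M₂ ⊎ Veronese.CrossCollinear M k L₁ M₂ L₂ M₁) →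
    (∃ λ (e : List (PartialLinearSpace.S M)) → length e < k ×
      Veronese.LineInLeaf M k L₁ e × Veronese.LineInLeaf M k L₂ e ×
      Veronese.LineInLeaf M k M₁ e × Veronese.LineInLeaf M k M₂ e)
    × (Veblenian (PartialLinearSpace.asIncidence M) → Meet (Veronese.V M k) M₁ M₂)
lemma1p7 𝔐 k _ p L₁ L₂ M₁ M₂ conf cross =
    ( base L₁ , base-short L₁
    , line-in-leaf L₁ L₁ SameLeaf-refl , line-in-leaf L₂ L₁ L₂~L₁
    , line-in-leaf M₁ L₁ M₁~L₁ , line-in-leaf M₂ L₁ M₂~L₁ )
  , veblen-in-leaf p L₁ L₂ M₁ M₂ conf leaves
  where
  open VeroneseGeometry 𝔐 k

  leaves : SameLeaf L₂ L₁ × SameLeaf M₁ L₁ × SameLeaf M₂ L₁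
  leaves = configuration-in-leaf p L₁ L₂ M₁ M₂ conf cross

  L₂~L₁ : SameLeaf L₂ L₁
  L₂~L₁ = proj₁ leaves

  M₁~L₁ : SameLeaf M₁ L₁
  M₁~L₁ = proj₁ (proj₂ leaves)

  M₂~L₁ : SameLeaf M₂ L₁
  M₂~L₁ = proj₂ (proj₂ leaves)
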